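{- The consequence relations determined by the matrices $\langle\mathbb{S}_6,[N)\rangle$ and $\langle\mathbb{S}_6,[B)\rangle$ coincide, where $[N)=\{N,\tfrac23,1\}$ and $[B)=\{B,\tfrac23,1\}$.
   Context: $\mathbb{S}_6$ is the algebra with universe $\{0,\tfrac13,N,B,\tfrac23,1\}$, lattice order $0<\tfrac13<N<\tfrac23<1$, $\tfrac13<B<\tfrac23$, $N,B$ incomparable; $\neg$ swaps $0\leftrightarrow1$, $\tfrac13\leftrightarrow\tfrac23$ and fixes $N,B$; $\nabla0=0$, $\nabla x=1$ for $x\ne0$. Formulas are built from a denumerable set of propositional variables with binary $\wedge,\vee$, unary $\neg,\nabla$ and constants $\bot,\top$; homomorphisms $h:\mathfrak{Fm}\to\mathbb{S}_6$ send $\bot\mapsto0,\top\mapsto1$. For a matrix $\langle\mathbb{S}_6,F\rangle$, $\Gamma\models\alpha$ iff every homomorphism $h$ with $h(\gamma)\in F$ for all $\gamma\in\Gamma$ has $h(\alpha)\in F$. -}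

module Defs where

open import Data.Nat using (ℕ)
open import Data.Product using (_×_)
open import Relation.Unary using (Pred)
open import Level using (0ℓ)

data S6 : Set where
  v0 vThird vN vB vTwoThirds v1 : S6

-- lattice meet and join (order: 0 < 1/3 < N,B < 2/3 < 1, N and B incomparable)
_∧₆_ : S6 → S6 → S6
v0 ∧₆ y = v0
x ∧₆ v0 = v0
vThird ∧₆ y = vThird
x ∧₆ vThird = vThird
v1 ∧₆ y = y
x ∧₆ v1 = x
vTwoThirds ∧₆ y = y
x ∧₆ vTwoThirds = x
vN ∧₆ vN = vN
vB ∧₆ vB = vB
vN ∧₆ vB = vThird
vB ∧₆ vN = vThird

_∨₆_ : S6 → S6 → S6
v1 ∨₆ y = v1
x ∨₆ v1 = v1
vTwoThirds ∨₆ y = vTwoThirds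
x ∨₆ vTwoThirds = vTwoThirds
v0 ∨₆ y = y
x ∨₆ v0 = x
vThird ∨₆ y = y
x ∨₆ vThird = x
vN ∨₆ vN = vN
vB ∨₆ vB = vB
vN ∨₆ vB = vTwoThirds
vB ∨₆ vN = vTwoThirds

¬₆_ : S6 → S6
¬₆ v0 = v1
¬₆ vThird = vTwoThirds
¬₆ vN = vN
¬₆ vB = vB
¬₆ vTwoThirds = vThird
¬₆ v1 = v0

∇₆_ : S6 → S6
∇₆ v0 = v0
∇₆ _ = v1

data Fm : Set where
  var  : ℕ → Fm
  _∧_  : Fm → Fm → Fm
  _∨_  : Fm → Fm → Fm
  ¬_   : Fm → Fm
  ∇_   : Fm → Fm
  ⊥'   : Fm
  ⊤'   : Fm

-- Homomorphisms Fm → S6 are exactly the extensions of valuations ℕ → S6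
hom : (ℕ → S6) → Fm → S6
hom v (var n) = v n
hom v (φ ∧ ψ) = hom v φ ∧₆ hom v ψ
hom v (φ ∨ ψ) = hom v φ ∨₆ hom v ψ
hom v (¬ φ) = ¬₆ hom v φ
hom v (∇ φ) = ∇₆ hom v φ
hom v ⊥' = v0
hom v ⊤' = v1

data FiltN : S6 → Set where
  inN  : FiltN vN
  in23 : FiltN vTwoThirds
  in1  : FiltN v1

data FiltB : S6 → Set where
  inB  : FiltB vB
  in23 : FiltB vTwoThirds
  in1  : FiltB v1

_⊨[_]_ : Pred Fm 0ℓ → Pred S6 0ℓ → Fm → Set
Γ ⊨[ F ] α = (v : ℕ → S6) → (∀ γ → Γ γ → F (hom v γ)) → F (hom v α)

-- The map swapping N and B and fixing the other four values is an automorphism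
-- of S6 that carries [N) onto [B). Composing valuations with it turns every
-- countermodel for one matrix into a countermodel for the other.
module Submission where

open import Defs
open import Data.Product using (_×_; _,_)
open import Function using (_∘_)
open import Relation.Unary using (Pred)
open import Level using (0ℓ)
open import Relation.Binary.PropositionalEquality using (_≡_; refl; sym; trans; cong; cong₂; subst)

record IsEndomorphism (g : S6 → S6) : Set where
  field
    ∧-homo : ∀ x y → g (x ∧₆ y) ≡ g x ∧₆ g y
    ∨-homo : ∀ x y → g (x ∨₆ y) ≡ g x ∨₆ g y
    ¬-homo : ∀ x → g (¬₆ x) ≡ ¬₆ g x
    ∇-homo : ∀ x → g (∇₆ x) ≡ ∇₆ g x
    0-homo : g v0 ≡ v0
    1-homo : g v1 ≡ v1

module _ {g : S6 → S6} (isEndo : IsEndomorphism g) where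
  open IsEndomorphism isEndo

  hom-∘ : ∀ v φ → hom (g ∘ v) φ ≡ g (hom v φ)
  hom-∘ v (var n) = refl
  hom-∘ v (φ ∧ ψ) = trans (cong₂ _∧₆_ (hom-∘ v φ) (hom-∘ v ψ)) (sym (∧-homo _ _))
  hom-∘ v (φ ∨ ψ) = trans (cong₂ _∨₆_ (hom-∘ v φ) (hom-∘ v ψ)) (sym (∨-homo _ _))
  hom-∘ v (¬ φ) = trans (cong ¬₆_ (hom-∘ v φ)) (sym (¬-homo _))
  hom-∘ v (∇ φ) = trans (cong ∇₆_ (hom-∘ v φ)) (sym (∇-homo _))
  hom-∘ v ⊥' = sym 0-homo
  hom-∘ v ⊤' = sym 1-homo

  ⊨-transfer : (F G : Pred S6 0ℓ) {Γ : Pred Fm 0ℓ} {α : Fm} →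
    (∀ {x} → G x → F (g x)) → (∀ {x} → F (g x) → G x) →
    Γ ⊨[ F ] α → Γ ⊨[ G ] α
  ⊨-transfer F G {α = α} G⇒F∘g F∘g⇒G Γ⊨α v Γ-holds =
    F∘g⇒G (subst F (hom-∘ v α) (Γ⊨α (g ∘ v) λ γ γ∈Γ →
      subst F (sym (hom-∘ v γ)) (G⇒F∘g (Γ-holds γ γ∈Γ))))

swapNB : S6 → S6
swapNB vN = vB
swapNB vB = vN
swapNB x = x

swapNB-involutive : ∀ x → swapNB (swapNB x) ≡ x
swapNB-involutive v0 = refl
swapNB-involutive vThird = refl
swapNB-involutive vN = refl
swapNB-involutive vB = refl
swapNB-involutive vTwoThirds = refl
swapNB-involutive v1 = refl

swapNB-∧ : ∀ x y → swapNB (x ∧₆ y) ≡ swapNB x ∧₆ swapNB y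
swapNB-∧ v0 y = refl
swapNB-∧ vThird v0 = refl
swapNB-∧ vThird vThird = refl
swapNB-∧ vThird vN = refl
swapNB-∧ vThird vB = refl
swapNB-∧ vThird vTwoThirds = refl
swapNB-∧ vThird v1 = refl
swapNB-∧ vN v0 = refl
swapNB-∧ vN vThird = refl
swapNB-∧ vN vN = refl
swapNB-∧ vN vB = refl
swapNB-∧ vN vTwoThirds = refl
swapNB-∧ vN v1 = refl
swapNB-∧ vB v0 = refl
swapNB-∧ vB vThird = refl
swapNB-∧ vB vN = refl
swapNB-∧ vB vB = refl
swapNB-∧ vB vTwoThirds = refl
swapNB-∧ vB v1 = refl
swapNB-∧ vTwoThirds v0 = refl
swapNB-∧ vTwoThirds vThird = refl
swapNB-∧ vTwoThirds vN = refl
swapNB-∧ vTwoThirds vB = refl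
swapNB-∧ vTwoThirds vTwoThirds = refl
swapNB-∧ vTwoThirds v1 = refl
swapNB-∧ v1 v0 = refl
swapNB-∧ v1 vThird = refl
swapNB-∧ v1 vN = refl
swapNB-∧ v1 vB = refl
swapNB-∧ v1 vTwoThirds = refl
swapNB-∧ v1 v1 = refl

swapNB-∨ : ∀ x y → swapNB (x ∨₆ y) ≡ swapNB x ∨₆ swapNB y
swapNB-∨ v1 y = refl
swapNB-∨ v0 v0 = refl
swapNB-∨ v0 vThird = refl
swapNB-∨ v0 vN = refl
swapNB-∨ v0 vB = refl
swapNB-∨ v0 vTwoThirds = refl
swapNB-∨ v0 v1 = refl
swapNB-∨ vThird v0 = refl
swapNB-∨ vThird vThird = refl
swapNB-∨ vThird vN = refl
swapNB-∨ vThird vB = refl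
swapNB-∨ vThird vTwoThirds = refl
swapNB-∨ vThird v1 = refl
swapNB-∨ vN v0 = refl
swapNB-∨ vN vThird = refl
swapNB-∨ vN vN = refl
swapNB-∨ vN vB = refl
swapNB-∨ vN vTwoThirds = refl
swapNB-∨ vN v1 = refl
swapNB-∨ vB v0 = refl
swapNB-∨ vB vThird = refl
swapNB-∨ vB vN = refl
swapNB-∨ vB vB = refl
swapNB-∨ vB vTwoThirds = refl
swapNB-∨ vB v1 = refl
swapNB-∨ vTwoThirds v0 = refl
swapNB-∨ vTwoThirds vThird = refl
swapNB-∨ vTwoThirds vN = refl
swapNB-∨ vTwoThirds vB = refl
swapNB-∨ vTwoThirds vTwoThirds = refl
swapNB-∨ vTwoThirds v1 = refl

swapNB-¬ : ∀ x → swapNB (¬₆ x) ≡ ¬₆ swapNB x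
swapNB-¬ v0 = refl
swapNB-¬ vThird = refl
swapNB-¬ vN = refl
swapNB-¬ vB = refl
swapNB-¬ vTwoThirds = refl
swapNB-¬ v1 = refl

swapNB-∇ : ∀ x → swapNB (∇₆ x) ≡ ∇₆ swapNB x
swapNB-∇ v0 = refl
swapNB-∇ vThird = refl
swapNB-∇ vN = refl
swapNB-∇ vB = refl
swapNB-∇ vTwoThirds = refl
swapNB-∇ v1 = refl

swapNB-isEndomorphism : IsEndomorphism swapNB
swapNB-isEndomorphism = record
  { ∧-homo = swapNB-∧
  ; ∨-homo = swapNB-∨
  ; ¬-homo = swapNB-¬
  ; ∇-homo = swapNB-∇
  ; 0-homo = refl
  ; 1-homo = refl
  }

FiltN⇒FiltB∘swapNB : ∀ {x} → FiltN x → FiltB (swapNB x)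
FiltN⇒FiltB∘swapNB inN = inB
FiltN⇒FiltB∘swapNB in23 = in23
FiltN⇒FiltB∘swapNB in1 = in1

FiltB⇒FiltN∘swapNB : ∀ {x} → FiltB x → FiltN (swapNB x)
FiltB⇒FiltN∘swapNB inB = inN
FiltB⇒FiltN∘swapNB in23 = in23
FiltB⇒FiltN∘swapNB in1 = in1

FiltN∘swapNB⇒FiltB : ∀ {x} → FiltN (swapNB x) → FiltB x
FiltN∘swapNB⇒FiltB {x} = subst FiltB (swapNB-involutive x) ∘ FiltN⇒FiltB∘swapNB

FiltB∘swapNB⇒FiltN : ∀ {x} → FiltB (swapNB x) → FiltN x
FiltB∘swapNB⇒FiltN {x} = subst FiltN (swapNB-involutive x) ∘ FiltB⇒FiltN∘swapNB

mainTheorem10 : (Γ : Pred Fm 0ℓ) (α : Fm) →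
    ((Γ ⊨[ FiltN ] α → Γ ⊨[ FiltB ] α) × (Γ ⊨[ FiltB ] α → Γ ⊨[ FiltN ] α))
mainTheorem10 Γ α =
    ⊨-transfer swapNB-isEndomorphism FiltN FiltB {α = α} FiltB⇒FiltN∘swapNB FiltN∘swapNB⇒FiltB
  , ⊨-transfer swapNB-isEndomorphism FiltB FiltN {α = α} FiltN⇒FiltB∘swapNB FiltB∘swapNB⇒FiltN
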